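{- Let $p\ge1$ and let $\phi_n$ ($n\ge1$) be the number of $BCI(p)$-terms of size $n(2p+1)-1$. Then $\phi_{n+1}/\phi_n=\Omega(n^p)$ as $n\to\infty$.
   Context: Lambda-terms are generated by the grammar $T::=x\mid (T*T)\mid \lambda x.T$; an abstraction $\lambda x.T$ binds the free occurrences of $x$ in $T$; a term is closed if no variable occurrence is free. Terms are counted up to renaming of bound variables. Equivalently a closed lambda-term is a rooted plane unary-binary tree (applications = binary nodes, abstractions = unary nodes, variable occurrences = leaves) with, for each leaf, a pointer from exactly one unary ancestor. Size: $|x|=1$, $|\lambda x.T|=1+|T|$, $|(S*T)|=1+|S|+|T|$. $BCI(p)$ is the set of (non-empty) closed lambda-terms in which every abstraction binds exactly $p$ variable occurrences. -}

module Defs where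

open import Data.Nat using (ℕ; zero; suc; _+_; _*_; _∸_)
open import Data.Fin using (Fin; zero; suc)
open import Data.Product using (Σ; _×_)
open import Relation.Binary.PropositionalEquality using (_≡_)

-- Lambda-terms with free variables among n de Bruijn indices.
-- Closed terms up to renaming of bound variables = Term 0.
data Term (n : ℕ) : Set where
  var : Fin n → Term n
  app : Term n → Term n → Term n
  lam : Term (suc n) → Term n

size : ∀ {n} → Term n → ℕ
size (var _)   = 1
size (app s t) = suc (size s + size t)
size (lam t)   = suc (size t)

occ : ∀ {n} → Fin n → Term n → ℕ
occ zero    (var zero)    = 1
occ zero    (var (suc _)) = 0
occ (suc i) (var zero)    = 0
occ (suc i) (var (suc j)) = occ i (var j)
occ i       (app s t)     = occ i s + occ i t
occ i       (lam t)       = occ (suc i) t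

data IsBCI (p : ℕ) : ∀ {n} → Term n → Set where
  var : ∀ {n} (i : Fin n) → IsBCI p (var i)
  app : ∀ {n} {s t : Term n} → IsBCI p s → IsBCI p t → IsBCI p (app s t)
  lam : ∀ {n} {t : Term (suc n)} → occ zero t ≡ p → IsBCI p t → IsBCI p (lam t)

BCITerms : ℕ → ℕ → Set
BCITerms p s = Σ (Term 0) (λ t → size t ≡ s × IsBCI p t)

phiSize : ℕ → ℕ → ℕ
phiSize p n = n * (2 * p + 1) ∸ 1

-- Given a term t counted by φ_{n+1}, of size (n+1)(2p+1) − 1 ≥ p(n+1), and a choice
-- c : Fin p → Fin (n+1), abstract a fresh variable x over t after replacing, for each j < p, the
-- subterm at preorder position j(n+1) + c j by x applied to it. This adds 2p + 1 nodes and gives a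
-- BCI(p)-term counted by φ_{n+2}. The inserted applications of x can be located again, so t and c
-- are recovered from the result, whence φ_{n+2} ≥ (n+1)^p φ_{n+1}.

module Submission where

open import Defs
open import Data.Nat using (ℕ; _*_; _^_; _≤_; suc)
open import Data.Fin using (Fin)
open import Data.Product using (Σ; _×_)
open import Function.Bundles using (_↔_)

open import Data.Nat using (zero; _+_; _∸_; pred; _<_; z≤n; s≤s; z<s; s<s)
open import Data.Nat.Properties
  using (+-assoc; +-suc; *-suc; *-identityˡ; ≡-irrelevant; module ≤-Reasoning)
open import Data.Nat.Tactic.RingSolver using (solve-∀)
open import Data.Fin using (zero; suc; punchIn; toℕ; combine; finToFun; funToFin)
open import Data.Fin.Properties
  using (punchIn-injective; punchInᵢ≢i; toℕ<n; toℕ-injective; funToFin-finToFin; *↔×; injective⇒≤)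
open import Data.Product using (_,_; proj₁; proj₂)
open import Data.Product.Function.NonDependent.Propositional using (_×-↔_)
open import Function using (_∘_; _$_)
open import Function.Bundles using (_↣_; mk↣; Injection)
open import Function.Properties.Inverse using (↔⇒↣)
open import Function.Construct.Composition using (_↣-∘_; _↔-∘_)
open import Function.Construct.Identity using (↔-id)
open import Function.Construct.Symmetry using (↔-sym)
open import Relation.Nullary using (¬_; contradiction)
open import Relation.Binary.PropositionalEquality

private
  variable
    n m p : ℕ

∑ : ℕ → (ℕ → ℕ) → ℕ
∑ zero    f = 0
∑ (suc m) f = f 0 + ∑ m (f ∘ suc)

shift : ℕ → (ℕ → ℕ) → ℕ → ℕ
shift k f i = f (k + i)

∑-zero : ∀ m → ∑ m (λ _ → 0) ≡ 0
∑-zero zero    = refl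
∑-zero (suc m) = ∑-zero m

∑-+ : ∀ a b f → ∑ (a + b) f ≡ ∑ a f + ∑ b (shift a f)
∑-+ zero    b f = refl
∑-+ (suc a) b f = trans (cong (f 0 +_) (∑-+ a b (f ∘ suc))) (sym (+-assoc (f 0) _ _))

AgreeBelow : ℕ → (ℕ → ℕ) → (ℕ → ℕ) → Set
AgreeBelow m f g = ∀ {i} → i < m → f i ≡ g i

AgreeBelow-suc : ∀ {f g} → f 0 ≡ g 0 → AgreeBelow m (f ∘ suc) (g ∘ suc) → AgreeBelow (suc m) f g
AgreeBelow-suc f0≡g0 _ {zero}  _         = f0≡g0
AgreeBelow-suc _     h {suc i} (s<s i<m) = h i<m

AgreeBelow-+ : ∀ a {b f g} → AgreeBelow a f g → AgreeBelow b (shift a f) (shift a g) →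
               AgreeBelow (a + b) f g
AgreeBelow-+ zero    _ h₂ = h₂
AgreeBelow-+ (suc a) {f = f} {g} h₁ h₂ =
  AgreeBelow-suc {f = f} {g} (h₁ z<s) (AgreeBelow-+ a (h₁ ∘ s<s) h₂)

block : ℕ → (ℕ → ℕ) → (ℕ → ℕ) → ℕ → ℕ
block zero    g h i       = h i
block (suc n) g h zero    = g 0
block (suc n) g h (suc i) = block n (g ∘ suc) h i

∑-block : ∀ n m g h → ∑ (n + m) (block n g h) ≡ ∑ n g + ∑ m h
∑-block zero    m g h = refl
∑-block (suc n) m g h = trans (cong (g 0 +_) (∑-block n m (g ∘ suc) h)) (sym (+-assoc (g 0) _ _))

AgreeBelow-block⁻¹ : ∀ n {g g′ h h′} → AgreeBelow (n + m) (block n g h) (block n g′ h′) →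
                     AgreeBelow n g g′ × AgreeBelow m h h′
AgreeBelow-block⁻¹ zero    agree = (λ ()) , agree
AgreeBelow-block⁻¹ (suc n) {g} {g′} agree with AgreeBelow-block⁻¹ n (agree ∘ s<s)
... | agree-g , agree-h = AgreeBelow-suc {f = g} {g′} (agree z<s) agree-g , agree-h

indicator : ℕ → ℕ → ℕ
indicator zero    zero    = 1
indicator zero    (suc i) = 0
indicator (suc c) zero    = 0
indicator (suc c) (suc i) = indicator c i

indicator-self : ∀ c → indicator c c ≡ 1
indicator-self zero    = refl
indicator-self (suc c) = indicator-self c

indicator≡1⇒≡ : ∀ c i → indicator c i ≡ 1 → c ≡ i
indicator≡1⇒≡ zero    zero    _ = refl
indicator≡1⇒≡ (suc c) (suc i) e = cong suc (indicator≡1⇒≡ c i e)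

∑-indicator : ∀ {c} → c < m → ∑ m (indicator c) ≡ 1
∑-indicator {suc m} {zero}  _         = cong suc (∑-zero m)
∑-indicator {suc m} {suc c} (s<s c<m) = ∑-indicator c<m

indicator-injective : ∀ {c c′} → c < m → AgreeBelow m (indicator c) (indicator c′) → c ≡ c′
indicator-injective {c = c} {c′} c<m agree =
  sym (indicator≡1⇒≡ c′ c (trans (sym (agree c<m)) (indicator-self c)))

-- mark c i = 1 if i = j * n + c j for some j < p, and 0 otherwise.
mark : (Fin p → Fin n) → ℕ → ℕ
mark {zero}      c = λ _ → 0
mark {suc p} {n} c = block n (indicator (toℕ (c zero))) (mark (c ∘ suc))

∑-mark : ∀ (c : Fin p → Fin n) r → ∑ (p * n + r) (mark c) ≡ p
∑-mark {zero}      c r = ∑-zero r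
∑-mark {suc p} {n} c r = begin
  ∑ (n + p * n + r) (mark c)
    ≡⟨ cong (λ m → ∑ m (mark c)) (+-assoc n (p * n) r) ⟩
  ∑ (n + (p * n + r)) (mark c)
    ≡⟨ ∑-block n (p * n + r) _ _ ⟩
  ∑ n (indicator (toℕ (c zero))) + ∑ (p * n + r) (mark (c ∘ suc))
    ≡⟨ cong₂ _+_ (∑-indicator (toℕ<n (c zero))) (∑-mark (c ∘ suc) r) ⟩
  suc p ∎
  where open ≡-Reasoning

mark-injective : ∀ {c c′ : Fin p → Fin n} r → AgreeBelow (p * n + r) (mark c) (mark c′) → c ≗ c′
mark-injective {suc p} {n} {c} r agree
  with AgreeBelow-block⁻¹ n (λ {j} → agree ∘ subst (j <_) (sym (+-assoc n (p * n) r)))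
... | agree-head , agree-tail = λ where
  zero    → toℕ-injective (indicator-injective (toℕ<n (c zero)) agree-head)
  (suc i) → mark-injective r agree-tail i

occ-app : ∀ (i : Fin n) s t → occ i (app s t) ≡ occ i s + occ i t
occ-app zero    s t = refl
occ-app (suc i) s t = refl

occ-lam : ∀ (i : Fin n) t → occ i (lam t) ≡ occ (suc i) t
occ-lam zero    t = refl
occ-lam (suc i) t = refl

occ-var-self : ∀ (i : Fin n) → occ i (var i) ≡ 1
occ-var-self zero    = refl
occ-var-self (suc i) = occ-var-self i

occ-punchIn-var : ∀ (v : Fin (suc n)) i → occ (punchIn v i) (var v) ≡ 0
occ-punchIn-var zero    i       = refl
occ-punchIn-var (suc v) zero    = refl
occ-punchIn-var (suc v) (suc i) = occ-punchIn-var v i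

occ-var-punchIn : ∀ (v : Fin (suc n)) j → occ v (var (punchIn v j)) ≡ 0
occ-var-punchIn zero    j       = refl
occ-var-punchIn (suc v) zero    = refl
occ-var-punchIn (suc v) (suc j) = occ-var-punchIn v j

occ-punchIn-punchIn : ∀ (v : Fin (suc n)) i j → occ (punchIn v i) (var (punchIn v j)) ≡ occ i (var j)
occ-punchIn-punchIn zero    i       j       = refl
occ-punchIn-punchIn (suc v) zero    zero    = refl
occ-punchIn-punchIn (suc v) zero    (suc j) = refl
occ-punchIn-punchIn (suc v) (suc i) zero    = refl
occ-punchIn-punchIn (suc v) (suc i) (suc j) = occ-punchIn-punchIn v i j

var-injective : ∀ {i j : Fin n} → Term.var i ≡ var j → i ≡ j
var-injective refl = refl

app-injective : ∀ {s t s′ t′ : Term n} → app s t ≡ app s′ t′ → s ≡ s′ × t ≡ t′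
app-injective refl = refl , refl

lam-injective : ∀ {t t′ : Term (suc n)} → lam t ≡ lam t′ → t ≡ t′
lam-injective refl = refl

applyVar : ℕ → Fin n → Term n → Term n
applyVar zero    v u = u
applyVar (suc k) v u = app (var v) (applyVar k v u)

size-applyVar : ∀ k (v : Fin n) u → size (applyVar k v u) ≡ 2 * k + size u
size-applyVar zero    v u = refl
size-applyVar (suc k) v u = begin
  suc (1 + size (applyVar k v u)) ≡⟨ cong (2 +_) (size-applyVar k v u) ⟩
  2 + (2 * k + size u)            ≡⟨ +-assoc 2 (2 * k) (size u) ⟨
  (2 + 2 * k) + size u            ≡⟨ cong (_+ size u) (*-suc 2 k) ⟨
  2 * suc k + size u              ∎
  where open ≡-Reasoning

occ-applyVar-self : ∀ k (v : Fin n) u → occ v (applyVar k v u) ≡ k + occ v u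
occ-applyVar-self zero    v u = refl
occ-applyVar-self (suc k) v u = begin
  occ v (app (var v) (applyVar k v u))   ≡⟨ occ-app v (var v) _ ⟩
  occ v (var v) + occ v (applyVar k v u) ≡⟨ cong₂ _+_ (occ-var-self v) (occ-applyVar-self k v u) ⟩
  suc (k + occ v u)                      ∎
  where open ≡-Reasoning

occ-punchIn-applyVar : ∀ k (v : Fin (suc n)) i u → occ (punchIn v i) (applyVar k v u) ≡ occ (punchIn v i) u
occ-punchIn-applyVar zero    v i u = refl
occ-punchIn-applyVar (suc k) v i u = begin
  occ (punchIn v i) (app (var v) (applyVar k v u))
    ≡⟨ occ-app (punchIn v i) (var v) _ ⟩
  occ (punchIn v i) (var v) + occ (punchIn v i) (applyVar k v u)
    ≡⟨ cong₂ _+_ (occ-punchIn-var v i) (occ-punchIn-applyVar k v i u) ⟩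
  occ (punchIn v i) u ∎
  where open ≡-Reasoning

IsBCI-applyVar : ∀ k (v : Fin n) {u} → IsBCI p u → IsBCI p (applyVar k v u)
IsBCI-applyVar zero    v bci = bci
IsBCI-applyVar (suc k) v bci = app (var v) (IsBCI-applyVar k v bci)

Headed : Fin n → Term n → Set
Headed v t = Σ (Term _) λ u → t ≡ app (var v) u

applyVar-injective : ∀ (v : Fin n) k k′ {u u′} → ¬ Headed v u → ¬ Headed v u′ →
                     applyVar k v u ≡ applyVar k′ v u′ → k ≡ k′ × u ≡ u′
applyVar-injective v zero    zero     _  _  eq = refl , eq
applyVar-injective v zero    (suc k′) ¬h _  eq = contradiction (_ , eq) ¬h
applyVar-injective v (suc k) zero     _  ¬h eq = contradiction (_ , sym eq) ¬h
applyVar-injective v (suc k) (suc k′) ¬h ¬h′ eq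
  with applyVar-injective v k k′ ¬h ¬h′ (proj₂ (app-injective eq))
... | refl , u≡u′ = refl , u≡u′

∑-size : ∀ (t : Term n) f → ∑ (size t) f ≡ f 0 + ∑ (pred (size t)) (f ∘ suc)
∑-size (var _)   f = refl
∑-size (app _ _) f = refl
∑-size (lam _)   f = refl

-- insert v f t weakens t by the fresh variable v and applies v, f i times, around the node of t
-- in preorder position i.
mutual
  insert : Fin (suc n) → (ℕ → ℕ) → Term n → Term (suc n)
  insert v f t = applyVar (f 0) v (insertNode v f t)

  insertNode : Fin (suc n) → (ℕ → ℕ) → Term n → Term (suc n)
  insertNode v f (var j)   = var (punchIn v j)
  insertNode v f (app s t) = app (insert v (f ∘ suc) s) (insert v (shift (suc (size s)) f) t)
  insertNode v f (lam t)   = lam (insert (suc v) (f ∘ suc) t)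

size-insert : ∀ (v : Fin (suc n)) f t → size (insert v f t) ≡ 2 * ∑ (size t) f + size t
size-insert v f t = begin
  size (applyVar (f 0) v (insertNode v f t))        ≡⟨ size-applyVar (f 0) v _ ⟩
  2 * f 0 + size (insertNode v f t)                 ≡⟨ cong (2 * f 0 +_) (node t) ⟩
  2 * f 0 + (2 * ∑ (pred (size t)) (f ∘ suc) + size t) ≡⟨ rearrange (f 0) _ (size t) ⟩
  2 * (f 0 + ∑ (pred (size t)) (f ∘ suc)) + size t  ≡⟨ cong (λ x → 2 * x + size t) (∑-size t f) ⟨
  2 * ∑ (size t) f + size t                         ∎
  where
  open ≡-Reasoning
  rearrange : ∀ x a c → 2 * x + (2 * a + c) ≡ 2 * (x + a) + c
  rearrange = solve-∀
  rearrange-app : ∀ a b c d → suc ((2 * a + c) + (2 * b + d)) ≡ 2 * (a + b) + suc (c + d)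
  rearrange-app = solve-∀
  node : ∀ t → size (insertNode v f t) ≡ 2 * ∑ (pred (size t)) (f ∘ suc) + size t
  node (var j)   = refl
  node (app s t) = begin
    suc (size (insert v (f ∘ suc) s) + size (insert v f′ t))
      ≡⟨ cong₂ (λ a b → suc (a + b)) (size-insert v (f ∘ suc) s) (size-insert v f′ t) ⟩
    suc ((2 * ∑ (size s) (f ∘ suc) + size s) + (2 * ∑ (size t) f′ + size t))
      ≡⟨ rearrange-app (∑ (size s) (f ∘ suc)) (∑ (size t) f′) (size s) (size t) ⟩
    2 * (∑ (size s) (f ∘ suc) + ∑ (size t) f′) + suc (size s + size t)
      ≡⟨ cong (λ x → 2 * x + suc (size s + size t)) (∑-+ (size s) (size t) (f ∘ suc)) ⟨
    2 * ∑ (size s + size t) (f ∘ suc) + suc (size s + size t) ∎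
    where f′ = shift (suc (size s)) f
  node (lam t)   = begin
    suc (size (insert (suc v) (f ∘ suc) t))  ≡⟨ cong suc (size-insert (suc v) (f ∘ suc) t) ⟩
    suc (2 * ∑ (size t) (f ∘ suc) + size t)  ≡⟨ +-suc _ (size t) ⟨
    2 * ∑ (size t) (f ∘ suc) + suc (size t)  ∎

occ-insert : ∀ (v : Fin (suc n)) f t → occ v (insert v f t) ≡ ∑ (size t) f
occ-insert v f t = begin
  occ v (applyVar (f 0) v (insertNode v f t)) ≡⟨ occ-applyVar-self (f 0) v _ ⟩
  f 0 + occ v (insertNode v f t)              ≡⟨ cong (f 0 +_) (node t) ⟩
  f 0 + ∑ (pred (size t)) (f ∘ suc)           ≡⟨ ∑-size t f ⟨
  ∑ (size t) f                                ∎
  where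
  open ≡-Reasoning
  node : ∀ t → occ v (insertNode v f t) ≡ ∑ (pred (size t)) (f ∘ suc)
  node (var j)   = occ-var-punchIn v j
  node (app s t) = begin
    occ v (app (insert v (f ∘ suc) s) (insert v (shift (suc (size s)) f) t))
      ≡⟨ occ-app v _ _ ⟩
    occ v (insert v (f ∘ suc) s) + occ v (insert v (shift (suc (size s)) f) t)
      ≡⟨ cong₂ _+_ (occ-insert v (f ∘ suc) s) (occ-insert v (shift (suc (size s)) f) t) ⟩
    ∑ (size s) (f ∘ suc) + ∑ (size t) (shift (suc (size s)) f)
      ≡⟨ ∑-+ (size s) (size t) (f ∘ suc) ⟨
    ∑ (size s + size t) (f ∘ suc) ∎
  node (lam t)   = trans (occ-lam v _) (occ-insert (suc v) (f ∘ suc) t)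

occ-punchIn-insert : ∀ (v : Fin (suc n)) f i t → occ (punchIn v i) (insert v f t) ≡ occ i t
occ-punchIn-insert v f i t = trans (occ-punchIn-applyVar (f 0) v i _) (node t)
  where
  node : ∀ t → occ (punchIn v i) (insertNode v f t) ≡ occ i t
  node (var j)   = occ-punchIn-punchIn v i j
  node (app s t) = begin
    occ (punchIn v i) (app (insert v (f ∘ suc) s) (insert v (shift (suc (size s)) f) t))
      ≡⟨ occ-app (punchIn v i) _ _ ⟩
    occ (punchIn v i) (insert v (f ∘ suc) s) + occ (punchIn v i) (insert v (shift (suc (size s)) f) t)
      ≡⟨ cong₂ _+_ (occ-punchIn-insert v (f ∘ suc) i s) (occ-punchIn-insert v _ i t) ⟩
    occ i s + occ i t
      ≡⟨ occ-app i s t ⟨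
    occ i (app s t) ∎
    where open ≡-Reasoning
  node (lam t)   = begin
    occ (punchIn v i) (lam (insert (suc v) (f ∘ suc) t)) ≡⟨ occ-lam (punchIn v i) _ ⟩
    occ (suc (punchIn v i)) (insert (suc v) (f ∘ suc) t) ≡⟨ occ-punchIn-insert (suc v) (f ∘ suc) (suc i) t ⟩
    occ (suc i) t                                        ≡⟨ occ-lam i t ⟨
    occ i (lam t)                                        ∎
    where open ≡-Reasoning

IsBCI-insert : ∀ (v : Fin (suc n)) f {t} → IsBCI p t → IsBCI p (insert v f t)
IsBCI-insert v f (var j)   = IsBCI-applyVar (f 0) v (var _)
IsBCI-insert v f (app s t) = IsBCI-applyVar (f 0) v (app (IsBCI-insert v _ s) (IsBCI-insert v _ t))
IsBCI-insert v f {lam t} (lam binds-p t-bci) = IsBCI-applyVar (f 0) v $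
  lam (trans (occ-punchIn-insert (suc v) (f ∘ suc) zero t) binds-p) (IsBCI-insert (suc v) _ t-bci)

insert-≢-var : ∀ (v : Fin (suc n)) f t → insert v f t ≢ var v
insert-≢-var v f t eq with f 0
insert-≢-var v f (var j) eq | zero  = punchInᵢ≢i v j (var-injective eq)
insert-≢-var v f t       () | suc _

insertNode-unheaded : ∀ (v : Fin (suc n)) f t → ¬ Headed v (insertNode v f t)
insertNode-unheaded v f (app s t) (_ , eq) = insert-≢-var v _ s (proj₁ (app-injective eq))

mutual
  insert-injective : ∀ (v : Fin (suc n)) {f g} t u → insert v f t ≡ insert v g u →
                     t ≡ u × AgreeBelow (size t) f g
  insert-injective v {f} {g} t u eq
    with applyVar-injective v (f 0) (g 0) (insertNode-unheaded v f t) (insertNode-unheaded v g u) eq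
  ... | f0≡g0 , eq′ = insertNode-injective v t u f0≡g0 eq′

  insertNode-injective : ∀ (v : Fin (suc n)) {f g} t u → f 0 ≡ g 0 →
                         insertNode v f t ≡ insertNode v g u → t ≡ u × AgreeBelow (size t) f g
  insertNode-injective v {f} {g} (var j) (var j′) f0≡g0 eq =
    cong var (punchIn-injective v j j′ (var-injective eq)) , AgreeBelow-suc {f = f} {g} f0≡g0 (λ ())
  insertNode-injective v {f} {g} (app s t) (app s′ t′) f0≡g0 eq
    with app-injective eq
  ... | eq₁ , eq₂ with insert-injective v s s′ eq₁
  ... | refl , agree-s with insert-injective v t t′ eq₂
  ... | refl , agree-t = refl , AgreeBelow-suc {f = f} {g} f0≡g0 (AgreeBelow-+ (size s) agree-s agree-t)
  insertNode-injective v {f} {g} (lam t) (lam t′) f0≡g0 eq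
    with insert-injective (suc v) t t′ (lam-injective eq)
  ... | refl , agree-t = refl , AgreeBelow-suc {f = f} {g} f0≡g0 agree-t

IsBCI-irrelevant : ∀ {t : Term n} (b b′ : IsBCI p t) → b ≡ b′
IsBCI-irrelevant (var i)   (var i)     = refl
IsBCI-irrelevant (app b c) (app b′ c′) = cong₂ app (IsBCI-irrelevant b b′) (IsBCI-irrelevant c c′)
IsBCI-irrelevant (lam e b) (lam e′ b′) = cong₂ lam (≡-irrelevant e e′) (IsBCI-irrelevant b b′)

BCITerms-≡ : ∀ {s} {x y : BCITerms p s} → proj₁ x ≡ proj₁ y → x ≡ y
BCITerms-≡ {x = t , size≡ , bci} {t , size≡′ , bci′} refl
  rewrite ≡-irrelevant size≡ size≡′ | IsBCI-irrelevant bci bci′ = refl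

finToFun-injective : ∀ {x y : Fin (m ^ n)} → finToFun {m} {n} x ≗ finToFun y → x ≡ y
finToFun-injective {m} {n} {x} {y} eq = begin
  x                                   ≡⟨ funToFin-finToFin {n} {m} x ⟨
  funToFin (finToFun {m} {n} x)       ≡⟨ funToFin-cong eq ⟩
  funToFin (finToFun {m} {n} y)       ≡⟨ funToFin-finToFin {n} {m} y ⟩
  y                                   ∎
  where
  funToFin-cong : ∀ {k} {f g : Fin k → Fin m} → f ≗ g → funToFin f ≡ funToFin g
  funToFin-cong {k = zero}  _  = refl
  funToFin-cong {k = suc k} eq = cong₂ combine (eq zero) (funToFin-cong (eq ∘ suc))
  open ≡-Reasoning

phiSize-suc : ∀ p n → phiSize p (suc n) ≡ p * suc n + (p * suc n + n)
phiSize-suc p n = cong (_∸ 1) (expand p n)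
  where
  expand : ∀ p n → suc n * (2 * p + 1) ≡ suc (p * suc n + (p * suc n + n))
  expand = solve-∀

phiSize-suc-suc : ∀ p n → phiSize p (suc (suc n)) ≡ suc (2 * p + phiSize p (suc n))
phiSize-suc-suc p n = begin
  phiSize p (suc (suc n))                        ≡⟨ phiSize-suc p (suc n) ⟩
  p * suc (suc n) + (p * suc (suc n) + suc n)    ≡⟨ expand p n ⟩
  suc (2 * p + (p * suc n + (p * suc n + n)))    ≡⟨ cong (λ s → suc (2 * p + s)) (phiSize-suc p n) ⟨
  suc (2 * p + phiSize p (suc n))                ∎
  where
  open ≡-Reasoning
  expand : ∀ p n → p * suc (suc n) + (p * suc (suc n) + suc n) ≡ suc (2 * p + (p * suc n + (p * suc n + n)))
  expand = solve-∀

extend-↣ : ∀ p n → (Fin (suc n ^ p) × BCITerms p (phiSize p (suc n))) ↣ BCITerms p (phiSize p (suc (suc n)))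
extend-↣ p n = mk↣ extend-injective
  where
  choice : Fin (suc n ^ p) → Fin p → Fin (suc n)
  choice = finToFun

  marks : Fin (suc n ^ p) → ℕ → ℕ
  marks x = mark (choice x)

  ∑-marks : ∀ x {t : Term 0} → size t ≡ phiSize p (suc n) → ∑ (size t) (marks x) ≡ p
  ∑-marks x size≡ = trans (cong (λ s → ∑ s (marks x)) (trans size≡ (phiSize-suc p n)))
                          (∑-mark (choice x) (p * suc n + n))

  extend : Fin (suc n ^ p) × BCITerms p (phiSize p (suc n)) → BCITerms p (phiSize p (suc (suc n)))
  extend (x , t , size≡ , bci) =
    lam (insert zero (marks x) t) , size-extended ,
    lam (trans (occ-insert zero (marks x) t) (∑-marks x size≡)) (IsBCI-insert zero (marks x) bci)
    where
    open ≡-Reasoning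
    size-extended : suc (size (insert zero (marks x) t)) ≡ phiSize p (suc (suc n))
    size-extended = begin
      suc (size (insert zero (marks x) t))         ≡⟨ cong suc (size-insert zero (marks x) t) ⟩
      suc (2 * ∑ (size t) (marks x) + size t)      ≡⟨ cong₂ (λ a b → suc (2 * a + b)) (∑-marks x size≡) size≡ ⟩
      suc (2 * p + phiSize p (suc n))              ≡⟨ phiSize-suc-suc p n ⟨
      phiSize p (suc (suc n))                      ∎

  extend-injective : ∀ {a b} → extend a ≡ extend b → a ≡ b
  extend-injective {x , t , size≡ , _} {x′ , t′ , _} eq
    with insert-injective zero {marks x} {marks x′} t t′ (lam-injective (cong proj₁ eq))
  ... | refl , agree = cong₂ _,_ x≡x′ (BCITerms-≡ refl)
    where
    x≡x′ : x ≡ x′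
    x≡x′ = finToFun-injective $ mark-injective {c = choice x} {choice x′} (p * suc n + n) $ λ {i} →
      agree ∘ subst (i <_) (sym (trans size≡ (phiSize-suc p n)))

-- The bound φ_{n+1} ≥ n^p φ_n holds for every p.
lemma3 : (p : ℕ) → 1 ≤ p →
    Σ ℕ λ a → Σ ℕ λ b → Σ ℕ λ N → (1 ≤ a) × (1 ≤ b) ×
      ((n k k′ : ℕ) → N ≤ n → 1 ≤ n →
        (Fin k ↔ BCITerms p (phiSize p n)) →
        (Fin k′ ↔ BCITerms p (phiSize p (suc n))) →
        a * (n ^ p) * k ≤ b * k′)
lemma3 p _ = 1 , 1 , 1 , s≤s z≤n , s≤s z≤n , bound
  where
  bound : (n k k′ : ℕ) → 1 ≤ n → 1 ≤ n →
          (Fin k ↔ BCITerms p (phiSize p n)) → (Fin k′ ↔ BCITerms p (phiSize p (suc n))) →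
          1 * (n ^ p) * k ≤ 1 * k′
  bound (suc n) k k′ _ _ φₙ φₙ₊₁ = begin
    1 * (suc n ^ p) * k ≡⟨ cong (_* k) (*-identityˡ (suc n ^ p)) ⟩
    suc n ^ p * k       ≤⟨ injective⇒≤ (Injection.injective embedding) ⟩
    k′                  ≡⟨ *-identityˡ k′ ⟨
    1 * k′              ∎
    where
    open ≤-Reasoning
    embedding : Fin (suc n ^ p * k) ↣ Fin k′
    embedding = ↔⇒↣ (↔-sym φₙ₊₁) ↣-∘ (extend-↣ p n ↣-∘ ↔⇒↣ ((↔-id _ ×-↔ φₙ) ↔-∘ *↔×))
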